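{- If $n=\binom{x}{\lfloor x/2\rfloor}+1$ for some positive integer $x$, then $t(S_n)=t(1,n)$, where $S_n=K_{1,n-1}$ is the star graph on $n$ vertices.
   Context: For a finite simple graph $G$, a $G$-CFF$(t,|V(G)|)$ is a family of subsets $B_v\subseteq[1,t]=\{1,\dots,t\}$, one for each vertex $v$, such that for every edge $\{a,b\}$: (i) $B_a\not\subseteq B_b$ and $B_b\not\subseteq B_a$, and (ii) for every vertex $w\notin\{a,b\}$, $B_w\not\subseteq B_a\cup B_b$. $t(G)$ is the minimum $t$ for which a $G$-CFF$(t,|V(G)|)$ exists. $t(1,n)$ is the minimum $t$ such that there exist $n$ subsets of $[1,t]$ none contained in another; equivalently $t(1,n)=\min\{t:\binom{t}{\lfloor t/2\rfloor}\ge n\}$. -}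

module Defs where

open import Data.Nat using (ℕ; zero; suc; _≤_)
open import Data.Fin using (Fin; zero; suc)
open import Data.Fin.Subset using (Subset; _⊆_; _∪_)
open import Data.Product using (Σ; _×_)
open import Relation.Nullary using (¬_)
open import Relation.Binary.PropositionalEquality using (_≡_; _≢_)

record Graph (n : ℕ) : Set₁ where
  field
    Adj   : Fin n → Fin n → Set
    sym   : ∀ {a b} → Adj a b → Adj b a
    irrefl : ∀ {a} → ¬ Adj a a
open Graph public

StarAdj : ∀ {n} → Fin n → Fin n → Set
StarAdj zero    zero    = Data.Empty.⊥ where import Data.Empty
StarAdj zero    (suc _) = Data.Unit.⊤ where import Data.Unit
StarAdj (suc _) zero    = Data.Unit.⊤ where import Data.Unit
StarAdj (suc _) (suc _) = Data.Empty.⊥ where import Data.Empty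

StarAdj-sym : ∀ {n} {a b : Fin n} → StarAdj a b → StarAdj b a
StarAdj-sym {a = zero}  {b = suc _} p = p
StarAdj-sym {a = suc _} {b = zero}  p = p

StarAdj-irrefl : ∀ {n} {a : Fin n} → ¬ StarAdj a a
StarAdj-irrefl {a = zero} ()
StarAdj-irrefl {a = suc _} ()

Star : (n : ℕ) → Graph n
Star n = record { Adj = StarAdj ; sym = StarAdj-sym ; irrefl = StarAdj-irrefl }

IsGCFF : ∀ {n} (G : Graph n) (t : ℕ) → (Fin n → Subset t) → Set
IsGCFF {n} G t B =
  ∀ a b → Adj G a b →
    (¬ (B a ⊆ B b)) × (¬ (B b ⊆ B a)) ×
    (∀ (w : Fin n) → w ≢ a → w ≢ b → ¬ (B w ⊆ (B a ∪ B b)))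

HasGCFF : ∀ {n} → Graph n → ℕ → Set
HasGCFF {n} G t = Σ (Fin n → Subset t) (IsGCFF G t)

HasAntichain : ℕ → ℕ → Set
HasAntichain n t = Σ (Fin n → Subset t) λ B → ∀ i j → i ≢ j → ¬ (B i ⊆ B j)

IsMinimum : (ℕ → Set) → ℕ → Set
IsMinimum P m = P m × (∀ k → P k → m ≤ k)

tG≡ : ∀ {n} → Graph n → ℕ → Set
tG≡ G m = IsMinimum (HasGCFF G) m

t1≡ : ℕ → ℕ → Set
t1≡ n m = IsMinimum (HasAntichain n) m

module Submission where

-- Upper bound: on x + 1 points, give the centre of the star the singleton of a new point and the
-- leaves the C(x, ⌈x/2⌉) = C(x, ⌊x/2⌋) subsets of size ⌈x/2⌉ of the other x points. These are
-- non-empty and pairwise incomparable, which is all that the cover-free conditions ask of a star.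
--
-- Lower bound: in a G-CFF of a graph without isolated vertices no set contains another (given
-- w ≠ b, pick a neighbour a of b: either a = w and the ends of the edge ab are incomparable, or
-- B_w ⊈ B_a ∪ B_b ⊇ B_b), so t(S_n) ≥ t(1,n); and by Sperner's theorem an antichain of
-- C(x,⌊x/2⌋) + 1 sets needs more than x points. Sperner's theorem comes from the de Bruijn–Tengbergen–Kruyswijk symmetric
-- chain decomposition: an antichain meets each chain at most once, and, by Pascal's rule along
-- the recursive construction, for 2k ≤ x at most C(x,k) of the chains start at rank ≤ k.

open import Defs
open import Data.Nat using (ℕ; zero; suc; _+_; _/_; _≥_; _≤_; _<_; _≤′_; ≤′-refl; ≤′-step; z≤n; s≤s; ⌊_/2⌋; ⌈_/2⌉)
open import Data.Nat.Properties hiding (_≟_)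
open import Data.Nat.DivMod using (m/n≡1+[m∸n]/n)
open import Data.Nat.Combinatorics using (_C_; nCk+nC[k+1]≡[n+1]C[k+1]; nCk≡nC[n∸k])
open import Data.Nat.ListAction using (sum)
open import Data.Nat.ListAction.Properties using (sum-++)
open import Data.Fin using (Fin; zero; suc; _≟_)
open import Data.Fin.Properties using (pigeonhole) renaming (<⇒≢ to <⇒≢ᶠ)
open import Data.Fin.Subset using (Subset; _⊆_; _⊇_; _⊈_; _∪_; ⊥; ∣_∣; Nonempty; inside; outside)
open import Data.Fin.Subset.Properties
  using (drop-∷-⊆; s⊆s; out⊆; ⊆-refl; q⊆p∪q; ∪-comm; ∪-identityˡ; p⊆q⇒∣p∣≤∣q∣; ∣⊥∣≡0; ∉⊥)
open import Data.List using (List; []; _∷_; _++_; map; length; lookup)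
open import Data.List.Properties using (length-map; length-++; map-++; map-∘)
open import Data.List.Membership.Propositional using (_∈_)
open import Data.List.Membership.Propositional.Properties using (∈-map⁺; ∈-lookup)
open import Data.List.Relation.Unary.All as All using (All; []; _∷_)
import Data.List.Relation.Unary.All.Properties as All
open import Data.List.Relation.Unary.Any as Any using (Any; here; there; index)
import Data.List.Relation.Unary.Any.Properties as Any
open import Data.List.Relation.Unary.AllPairs as AllPairs using (AllPairs; []; _∷_)
import Data.List.Relation.Unary.AllPairs.Properties as AllPairs
open import Data.Product as Product using (Σ; ∃-syntax; _×_; _,_; proj₁; proj₂; swap)
open import Data.Sum using (_⊎_; inj₁; inj₂; [_,_]′)
open import Data.Unit using (tt)
open import Data.Vec using ([]; _∷_; here; there)
open import Function using (_∘_; id; flip)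
open import Relation.Binary.Definitions using (Reflexive; Symmetric)
open import Relation.Binary.PropositionalEquality
  using (_≡_; _≢_; refl; trans; cong; cong₂; subst; subst₂; module ≡-Reasoning)
import Relation.Binary.PropositionalEquality as ≡
open import Relation.Nullary using (¬_; yes; no; contradiction)

m+m≤n⇒m≤⌊n/2⌋ : ∀ {m n} → m + m ≤ n → m ≤ ⌊ n /2⌋
m+m≤n⇒m≤⌊n/2⌋ {m} m+m≤n = subst (_≤ _) (≡.sym (n≡⌊n+n/2⌋ m)) (⌊n/2⌋-mono m+m≤n)

C-complement : ∀ {n} k l → k + l ≡ n → n C k ≡ n C l
C-complement k l refl = trans (nCk≡nC[n∸k] (m≤m+n k l)) (cong ((k + l) C_) (m+n∸m≡n k l))

0<nCk : ∀ {n k} → k ≤ n → 0 < n C k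
0<nCk {k = zero}      _         = s≤s z≤n
0<nCk {suc n} {suc k} (s≤s k≤n) =
  subst (0 <_) (nCk+nC[k+1]≡[n+1]C[k+1] n k) (≤-trans (0<nCk k≤n) (m≤m+n (n C k) (n C suc k)))

n/2≡⌊n/2⌋ : ∀ n → n / 2 ≡ ⌊ n /2⌋
n/2≡⌊n/2⌋ 0             = refl
n/2≡⌊n/2⌋ 1             = refl
n/2≡⌊n/2⌋ (suc (suc n)) = trans (m/n≡1+[m∸n]/n {suc (suc n)} (s≤s (s≤s z≤n))) (cong suc (n/2≡⌊n/2⌋ n))

Antichain : ∀ {A : Set} {n} → (A → A → Set) → (Fin n → A) → Set
Antichain _≼_ f = ∀ i j → i ≢ j → ¬ (f i ≼ f j)

IsChain : ∀ {A : Set} → (A → A → Set) → List A → Set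
IsChain _≼_ c = ∀ {a b} → a ∈ c → b ∈ c → a ≼ b ⊎ b ≼ a

descending⇒chain : ∀ {A : Set} {_≼_ : A → A → Set} → Reflexive _≼_ →
                   ∀ {c} → AllPairs (flip _≼_) c → IsChain _≼_ c
descending⇒chain refl′ (_ ∷ _)  (here refl) (here refl) = inj₁ refl′
descending⇒chain refl′ (b≼ ∷ _) (here refl) (there b∈)  = inj₂ (All.lookup b≼ b∈)
descending⇒chain refl′ (a≼ ∷ _) (there a∈)  (here refl) = inj₁ (All.lookup a≼ a∈)
descending⇒chain refl′ (_ ∷ d)  (there a∈)  (there b∈)  = descending⇒chain refl′ d a∈ b∈

antichain≤#chains : ∀ {A : Set} {_≼_ : A → A → Set} {n} {f : Fin n → A} (cs : List (List A)) →
                    All (IsChain _≼_) cs → (∀ i → Any (f i ∈_) cs) → Antichain _≼_ f → n ≤ length cs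
antichain≤#chains {_≼_ = _≼_} {f = f} cs isChain cover anti = ≮⇒≥ collision
  where
  comparable : ∀ i j → index (cover i) ≡ index (cover j) → f i ≼ f j ⊎ f j ≼ f i
  comparable i j same = All.lookup isChain (∈-lookup (index (cover j)))
    (subst (λ k → f i ∈ lookup cs k) same (Any.lookup-index (cover i)))
    (Any.lookup-index (cover j))

  collision : ¬ (length cs < _)
  collision cs<n with i , j , i<j , same ← pigeonhole cs<n (index ∘ cover) =
    [ anti i j (<⇒≢ᶠ i<j) , anti j i (<⇒≢ᶠ i<j ∘ ≡.sym) ]′ (comparable i j same)

-- A chain is listed from the top down; bottomRank is not computed from the sets but is a
-- counter that the construction keeps equal to the size of the bottom set.
record Chain (x : ℕ) : Set where
  constructor chain
  field
    top        : Subset x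
    below      : List (Subset x)
    bottomRank : ℕ

  members : List (Subset x)
  members = top ∷ below

open Chain

-- A chain A₁ ⊂ … ⊂ Aₖ of subsets of [x] gives the chains A₁ ⊂ … ⊂ Aₖ ⊂ Aₖ + new (extend) and, when
-- k > 1, A₁ + new ⊂ … ⊂ Aₖ₋₁ + new (lowered) of [x + 1]; the new point is the first coordinate.
extend : ∀ {x} → Chain x → Chain (suc x)
extend (chain t bs r) = chain (inside ∷ t) (map (outside ∷_) (t ∷ bs)) r

lowered : ∀ {x} → List (Chain x) → List (Chain (suc x))
lowered []                        = []
lowered (chain _ []       _ ∷ cs) = lowered cs
lowered (chain _ (b ∷ bs) r ∷ cs) = chain (inside ∷ b) (map (inside ∷_) bs) (suc r) ∷ lowered cs

chains : ∀ x → List (Chain x)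
chains zero    = chain [] [] 0 ∷ []
chains (suc x) = map extend (chains x) ++ lowered (chains x)

Descending : ∀ {x} → Chain x → Set
Descending c = AllPairs _⊇_ (members c)

extend-descending : ∀ {x} {c : Chain x} → Descending c → Descending (extend c)
extend-descending d@(b⊆t ∷ _) = All.map⁺ (All.map out⊆ (⊆-refl ∷ b⊆t)) ∷ AllPairs.map⁺ (AllPairs.map s⊆s d)

lowered-descending : ∀ {x} {cs : List (Chain x)} → All Descending cs → All Descending (lowered cs)
lowered-descending {cs = []}                    []            = []
lowered-descending {cs = chain _ []      _ ∷ _} (_ ∷ ds)      = lowered-descending ds
lowered-descending {cs = chain _ (_ ∷ _) _ ∷ _} ((_ ∷ d) ∷ ds) =
  AllPairs.map⁺ (AllPairs.map s⊆s d) ∷ lowered-descending ds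

chains-descending : ∀ x → All Descending (chains x)
chains-descending zero    = ([] ∷ []) ∷ []
chains-descending (suc x) = All.++⁺ (All.map⁺ (All.map (λ {c} → extend-descending {c = c}) (chains-descending x)))
                                    (lowered-descending (chains-descending x))

lowered-covers : ∀ {x} {p : Subset x} {cs : List (Chain x)} →
                 Any (λ c → p ∈ below c) cs → Any (λ c → inside ∷ p ∈ members c) (lowered cs)
lowered-covers {cs = chain _ []      _ ∷ _} (there h) = lowered-covers h
lowered-covers {cs = chain _ (_ ∷ _) _ ∷ _} (here p∈) = here (∈-map⁺ (inside ∷_) p∈)
lowered-covers {cs = chain _ (_ ∷ _) _ ∷ _} (there h) = there (lowered-covers h)

chains-cover : ∀ x (p : Subset x) → Any (λ c → p ∈ members c) (chains x)
chains-cover zero    []            = here (here refl)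
chains-cover (suc x) (outside ∷ p) =
  Any.++⁺ˡ (Any.map⁺ (Any.map (there ∘ ∈-map⁺ (outside ∷_)) (chains-cover x p)))
chains-cover (suc x) (inside ∷ p)
  with Any.Any-⊎⁻ (Any.map Any.toSum (chains-cover x p))
... | inj₁ atTop  = Any.++⁺ˡ (Any.map⁺ (Any.map (here ∘ cong (inside ∷_)) atTop))
... | inj₂ atBelow = Any.++⁺ʳ (map extend (chains x)) (lowered-covers atBelow)

-- The bottom and top sets have sizes r and r + length below, which add up to x.
IsSymmetric : ∀ {x} → Chain x → Set
IsSymmetric {x} c = length (below c) + (bottomRank c + bottomRank c) ≡ x

extend-symmetric : ∀ {x} {c : Chain x} → IsSymmetric c → IsSymmetric (extend c)
extend-symmetric {c = chain _ bs r} s = cong suc (trans (cong (_+ (r + r)) (length-map (outside ∷_) bs)) s)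

lowered-symmetric : ∀ {x} {cs : List (Chain x)} → All IsSymmetric cs → All IsSymmetric (lowered cs)
lowered-symmetric {cs = []}                     []       = []
lowered-symmetric {cs = chain _ []       _ ∷ _} (_ ∷ ss) = lowered-symmetric ss
lowered-symmetric {x} {cs = chain _ (_ ∷ bs) r ∷ _} (s ∷ ss) = shift ∷ lowered-symmetric ss
  where
  open ≡-Reasoning
  shift : length (map (inside ∷_) bs) + (suc r + suc r) ≡ suc x
  shift = begin
    length (map (inside ∷_) bs) + (suc r + suc r) ≡⟨ cong (_+ (suc r + suc r)) (length-map (inside ∷_) bs) ⟩
    length bs + suc (r + suc r)                   ≡⟨ +-suc (length bs) (r + suc r) ⟩
    suc (length bs + (r + suc r))                 ≡⟨ cong (λ m → suc (length bs + m)) (+-suc r r) ⟩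
    suc (length bs + suc (r + r))                 ≡⟨ cong suc (+-suc (length bs) (r + r)) ⟩
    suc (suc (length bs + (r + r)))               ≡⟨ cong suc s ⟩
    suc x                                         ∎

chains-symmetric : ∀ x → All IsSymmetric (chains x)
chains-symmetric zero    = refl ∷ []
chains-symmetric (suc x) = All.++⁺ (All.map⁺ (All.map (λ {c} → extend-symmetric {c = c}) (chains-symmetric x)))
                                   (lowered-symmetric (chains-symmetric x))

bottomRank≤⌊x/2⌋ : ∀ {x} {c : Chain x} → IsSymmetric c → bottomRank c ≤ ⌊ x /2⌋
bottomRank≤⌊x/2⌋ {c = c} s = m+m≤n⇒m≤⌊n/2⌋ (subst (_ ≤_) s (m≤n+m _ (length (below c))))

-- Defined by recursion on both arguments so that 𝟙[ suc r ≤ suc k ] reduces to 𝟙[ r ≤ k ].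
𝟙[_≤_] : ℕ → ℕ → ℕ
𝟙[ zero  ≤ _     ] = 1
𝟙[ suc _ ≤ zero  ] = 0
𝟙[ suc r ≤ suc k ] = 𝟙[ r ≤ k ]

𝟙[≤]≡1 : ∀ {r k} → r ≤ k → 𝟙[ r ≤ k ] ≡ 1
𝟙[≤]≡1 z≤n       = refl
𝟙[≤]≡1 (s≤s r≤k) = 𝟙[≤]≡1 r≤k

#bottom≤ : ∀ {x} → ℕ → List (Chain x) → ℕ
#bottom≤ k cs = sum (map (λ c → 𝟙[ bottomRank c ≤ k ]) cs)

#bottom≤-++ : ∀ {x} k (cs ds : List (Chain x)) → #bottom≤ k (cs ++ ds) ≡ #bottom≤ k cs + #bottom≤ k ds
#bottom≤-++ k cs ds = trans (cong sum (map-++ _ cs ds)) (sum-++ (map _ cs) _)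

#bottom≤-extend : ∀ {x} k (cs : List (Chain x)) → #bottom≤ k (map extend cs) ≡ #bottom≤ k cs
#bottom≤-extend k cs = cong sum (≡.sym (map-∘ cs))

#bottom≤-lowered : ∀ {x} k (cs : List (Chain x)) → #bottom≤ (suc k) (lowered cs) ≤ #bottom≤ k cs
#bottom≤-lowered k []                        = z≤n
#bottom≤-lowered k (chain _ []      r ∷ cs) = ≤-trans (#bottom≤-lowered k cs) (m≤n+m _ 𝟙[ r ≤ k ])
#bottom≤-lowered k (chain _ (_ ∷ _) r ∷ cs) = +-monoʳ-≤ 𝟙[ r ≤ k ] (#bottom≤-lowered k cs)

#bottom≤0-lowered : ∀ {x} (cs : List (Chain x)) → #bottom≤ 0 (lowered cs) ≡ 0
#bottom≤0-lowered []                      = refl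
#bottom≤0-lowered (chain _ []      _ ∷ cs) = #bottom≤0-lowered cs
#bottom≤0-lowered (chain _ (_ ∷ _) _ ∷ cs) = #bottom≤0-lowered cs

#bottom≤-all : ∀ {x} {k} {cs : List (Chain x)} → All (λ c → bottomRank c ≤ k) cs → #bottom≤ k cs ≡ length cs
#bottom≤-all []           = refl
#bottom≤-all (r≤k ∷ r≤ks) = cong₂ _+_ (𝟙[≤]≡1 r≤k) (#bottom≤-all r≤ks)

#bottom≤-step : ∀ x k → #bottom≤ (suc k) (chains (suc x)) ≤ #bottom≤ (suc k) (chains x) + #bottom≤ k (chains x)
#bottom≤-step x k = begin
  #bottom≤ (suc k) (map extend cs ++ lowered cs)
    ≡⟨ #bottom≤-++ (suc k) (map extend cs) (lowered cs) ⟩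
  #bottom≤ (suc k) (map extend cs) + #bottom≤ (suc k) (lowered cs)
    ≤⟨ +-mono-≤ (≤-reflexive (#bottom≤-extend (suc k) cs)) (#bottom≤-lowered k cs) ⟩
  #bottom≤ (suc k) cs + #bottom≤ k cs
    ∎
  where
  open ≤-Reasoning
  cs = chains x

#bottom≤0-chains : ∀ x → #bottom≤ 0 (chains x) ≡ 1
#bottom≤0-chains zero    = refl
#bottom≤0-chains (suc x) = begin
  #bottom≤ 0 (map extend cs ++ lowered cs)           ≡⟨ #bottom≤-++ 0 (map extend cs) (lowered cs) ⟩
  #bottom≤ 0 (map extend cs) + #bottom≤ 0 (lowered cs) ≡⟨ cong₂ _+_ (#bottom≤-extend 0 cs) (#bottom≤0-lowered cs) ⟩
  #bottom≤ 0 cs + 0                                  ≡⟨ +-identityʳ _ ⟩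
  #bottom≤ 0 cs                                      ≡⟨ #bottom≤0-chains x ⟩
  1                                                  ∎
  where
  open ≡-Reasoning
  cs = chains x

#bottom≤-saturated : ∀ x {k} → ⌊ x /2⌋ ≤ k → #bottom≤ k (chains x) ≡ length (chains x)
#bottom≤-saturated x ⌊x/2⌋≤k = #bottom≤-all (All.map (λ {c} s → ≤-trans (bottomRank≤⌊x/2⌋ {c = c} s) ⌊x/2⌋≤k) (chains-symmetric x))

#bottom≤-chains : ∀ x k → k + k ≤ x → #bottom≤ k (chains x) ≤ x C k
#bottom≤-chains x       zero    _ = ≤-reflexive (#bottom≤0-chains x)
#bottom≤-chains (suc x) (suc k) 2k+2≤x+1 = begin
  #bottom≤ (suc k) (chains (suc x))                  ≤⟨ #bottom≤-step x k ⟩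
  #bottom≤ (suc k) (chains x) + #bottom≤ k (chains x) ≤⟨ +-mono-≤ upper (#bottom≤-chains x k 2k≤x) ⟩
  x C suc k + x C k                                  ≡⟨ +-comm (x C suc k) (x C k) ⟩
  x C k + x C suc k                                  ≡⟨ nCk+nC[k+1]≡[n+1]C[k+1] x k ⟩
  suc x C suc k                                      ∎
  where
  open ≤-Reasoning
  2k≤x : k + k ≤ x
  2k≤x = ≤-trans (+-monoʳ-≤ k (n≤1+n k)) (≤-pred 2k+2≤x+1)

  upper : #bottom≤ (suc k) (chains x) ≤ x C suc k
  upper with m≤n⇒m<n∨m≡n 2k+2≤x+1
  ... | inj₁ 2k+2≤x = #bottom≤-chains x (suc k) (≤-pred 2k+2≤x)
  ... | inj₂ 2k+2≡x+1 = begin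
    #bottom≤ (suc k) (chains x) ≡⟨ #bottom≤-saturated x (≤-trans ⌊x/2⌋≤k (n≤1+n k)) ⟩
    length (chains x)           ≡⟨ #bottom≤-saturated x ⌊x/2⌋≤k ⟨
    #bottom≤ k (chains x)       ≤⟨ #bottom≤-chains x k 2k≤x ⟩
    x C k                       ≡⟨ C-complement k (suc k) x≡2k+1 ⟩
    x C suc k                   ∎
    where
    x≡2k+1 : k + suc k ≡ x
    x≡2k+1 = suc-injective 2k+2≡x+1
    ⌊x/2⌋≤k : ⌊ x /2⌋ ≤ k
    ⌊x/2⌋≤k = ≤-reflexive (trans (cong ⌊_/2⌋ (trans (≡.sym x≡2k+1) (+-suc k k))) (≡.sym (n≡⌈n+n/2⌉ k)))

#chains≤central : ∀ x → length (chains x) ≤ x C ⌊ x /2⌋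
#chains≤central x = begin
  length (chains x)            ≡⟨ #bottom≤-saturated x ≤-refl ⟨
  #bottom≤ ⌊ x /2⌋ (chains x)  ≤⟨ #bottom≤-chains x ⌊ x /2⌋ 2⌊x/2⌋≤x ⟩
  x C ⌊ x /2⌋                  ∎
  where
  open ≤-Reasoning
  2⌊x/2⌋≤x : ⌊ x /2⌋ + ⌊ x /2⌋ ≤ x
  2⌊x/2⌋≤x = ≤-trans (+-monoʳ-≤ ⌊ x /2⌋ (⌊n/2⌋≤⌈n/2⌉ x)) (≤-reflexive (⌊n/2⌋+⌈n/2⌉≡n x))

sperner : ∀ {n t} → HasAntichain n t → n ≤ t C ⌊ t /2⌋
sperner {t = t} (B , anti) = ≤-trans
  (antichain≤#chains (map members (chains t))
    (All.map⁺ (All.map (descending⇒chain {_≼_ = _⊆_} ⊆-refl) (chains-descending t)))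
    (λ i → Any.map⁺ (chains-cover t (B i)))
    anti)
  (≤-trans (≤-reflexive (length-map members (chains t))) (#chains≤central t))

hasAntichain-mono : ∀ {n t u} → t ≤ u → HasAntichain n t → HasAntichain n u
hasAntichain-mono = go ∘ ≤⇒≤′
  where
  go : ∀ {n t u} → t ≤′ u → HasAntichain n t → HasAntichain n u
  go ≤′-refl        = id
  go (≤′-step t≤′u) = Product.map ((outside ∷_) ∘_) (λ anti i j i≢j → anti i j i≢j ∘ drop-∷-⊆) ∘ go t≤′u

antichain-lower-bound : ∀ {x k} → HasAntichain (suc (x C ⌊ x /2⌋)) k → x < k
antichain-lower-bound {x} A = ≰⇒> λ k≤x → n≮n _ (sperner (hasAntichain-mono k≤x A))

layer : ∀ x (k : ℕ) → List (Subset x)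
layer x       zero    = ⊥ ∷ []
layer zero    (suc k) = []
layer (suc x) (suc k) = map (inside ∷_) (layer x k) ++ map (outside ∷_) (layer x (suc k))

length-layer : ∀ x (k : ℕ) → length (layer x k) ≡ x C k
length-layer x       zero    = refl
length-layer zero    (suc k) = refl
length-layer (suc x) (suc k) = begin
  length (map (inside ∷_) (layer x k) ++ map (outside ∷_) (layer x (suc k)))
    ≡⟨ length-++ (map (inside ∷_) (layer x k)) ⟩
  length (map (inside ∷_) (layer x k)) + length (map (outside ∷_) (layer x (suc k)))
    ≡⟨ cong₂ _+_ (length-map (inside ∷_) (layer x k)) (length-map (outside ∷_) (layer x (suc k))) ⟩
  length (layer x k) + length (layer x (suc k))
    ≡⟨ cong₂ _+_ (length-layer x k) (length-layer x (suc k)) ⟩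
  x C k + x C suc k
    ≡⟨ nCk+nC[k+1]≡[n+1]C[k+1] x k ⟩
  suc x C suc k
    ∎
  where open ≡-Reasoning

layer-size : ∀ x (k : ℕ) → All (λ p → ∣ p ∣ ≡ k) (layer x k)
layer-size x       zero    = ∣⊥∣≡0 x ∷ []
layer-size zero    (suc k) = []
layer-size (suc x) (suc k) = All.++⁺ (All.map⁺ (All.map (cong suc) (layer-size x k))) (All.map⁺ (layer-size x (suc k)))

_∥_ : ∀ {n} → Subset n → Subset n → Set
p ∥ q = p ⊈ q × q ⊈ p

∥-∷ : ∀ {n} {p q : Subset n} s → p ∥ q → (s ∷ p) ∥ (s ∷ q)
∥-∷ _ (p⊈q , q⊈p) = p⊈q ∘ drop-∷-⊆ , q⊈p ∘ drop-∷-⊆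

inside⊈outside : ∀ {n} {p q : Subset n} → inside ∷ p ⊈ outside ∷ q
inside⊈outside sub with () ← sub here

inside∷p∥outside∷q : ∀ {n} {p q : Subset n} → ∣ p ∣ < ∣ q ∣ → (inside ∷ p) ∥ (outside ∷ q)
inside∷p∥outside∷q ∣p∣<∣q∣ = inside⊈outside , <⇒≱ ∣p∣<∣q∣ ∘ p⊆q⇒∣p∣≤∣q∣ ∘ drop-∷-⊆

layer-incomparable : ∀ x (k : ℕ) → AllPairs _∥_ (layer x k)
layer-incomparable x       zero    = [] ∷ []
layer-incomparable zero    (suc k) = []
layer-incomparable (suc x) (suc k) = AllPairs.++⁺
  (AllPairs.map⁺ (AllPairs.map (∥-∷ inside) (layer-incomparable x k)))
  (AllPairs.map⁺ (AllPairs.map (∥-∷ outside) (layer-incomparable x (suc k))))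
  (All.map⁺ (All.map (λ ∣p∣≡k → All.map⁺ (All.map (across ∣p∣≡k) (layer-size x (suc k)))) (layer-size x k)))
  where
  across : ∀ {p q : Subset x} → ∣ p ∣ ≡ k → ∣ q ∣ ≡ suc k → (inside ∷ p) ∥ (outside ∷ q)
  across ∣p∣≡k ∣q∣≡1+k = inside∷p∥outside∷q (subst₂ _<_ (≡.sym ∣p∣≡k) (≡.sym ∣q∣≡1+k) (n<1+n k))

AllPairs-lookup : ∀ {A : Set} {R : A → A → Set} → Symmetric R →
                  ∀ {xs} → AllPairs R xs → ∀ {i j} → i ≢ j → R (lookup xs i) (lookup xs j)
AllPairs-lookup _     (_ ∷ _)   {zero}  {zero}  i≢j = contradiction refl i≢j
AllPairs-lookup _     (Rx ∷ _)  {zero}  {suc j} _   = All.lookup Rx (∈-lookup j)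
AllPairs-lookup sym′  (Rx ∷ _)  {suc i} {zero}  _   = sym′ (All.lookup Rx (∈-lookup i))
AllPairs-lookup sym′  (_ ∷ Rxs) {suc i} {suc j} i≢j = AllPairs-lookup sym′ Rxs (i≢j ∘ cong suc)

layer-antichain : ∀ x (k : ℕ) → Antichain _⊆_ (lookup (layer x k))
layer-antichain x k i j i≢j = proj₁ (AllPairs-lookup swap (layer-incomparable x k) i≢j)

CoverFreeEdge : ∀ {n t} → (Fin n → Subset t) → Fin n → Fin n → Set
CoverFreeEdge {n} B a b =
  ¬ (B a ⊆ B b) × ¬ (B b ⊆ B a) × (∀ (w : Fin n) → w ≢ a → w ≢ b → ¬ (B w ⊆ (B a ∪ B b)))

coverFreeEdge-sym : ∀ {n t} {B : Fin n → Subset t} {a b} → CoverFreeEdge B a b → CoverFreeEdge B b a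
coverFreeEdge-sym {B = B} {a} {b} (a⊈b , b⊈a , w⊈a∪b) =
  b⊈a , a⊈b , λ w w≢b w≢a → w⊈a∪b w w≢a w≢b ∘ subst (B w ⊆_) (∪-comm (B b) (B a))

NoIsolatedVertex : ∀ {n} → Graph n → Set
NoIsolatedVertex {n} G = ∀ (b : Fin n) → ∃[ a ] Adj G a b

cff⇒antichain : ∀ {n t} {G : Graph n} {B : Fin n → Subset t} →
                NoIsolatedVertex G → IsGCFF G t B → Antichain _⊆_ B
cff⇒antichain {B = B} noIsolated cff w b w≢b Bw⊆Bb with noIsolated b
... | a , a~b with a ≟ w
...   | yes refl = proj₁ (cff a b a~b) Bw⊆Bb
...   | no a≢w   = proj₂ (proj₂ (cff a b a~b)) w (a≢w ∘ ≡.sym) w≢b (q⊆p∪q (B a) (B b) ∘ Bw⊆Bb)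

star-noIsolatedVertex : ∀ {n} → 2 ≤ n → NoIsolatedVertex (Star n)
star-noIsolatedVertex (s≤s (s≤s z≤n)) zero    = suc zero , tt
star-noIsolatedVertex (s≤s (s≤s z≤n)) (suc _) = zero , tt

nonempty⇐∣p∣>0 : ∀ {n} (p : Subset n) → 0 < ∣ p ∣ → Nonempty p
nonempty⇐∣p∣>0 (inside  ∷ p) _       = zero , here
nonempty⇐∣p∣>0 (outside ∷ p) 0<∣p∣ = Product.map suc there (nonempty⇐∣p∣>0 p 0<∣p∣)

star-cff : ∀ {m x} (A : Fin m → Subset x) → Antichain _⊆_ A → (∀ i → Nonempty (A i)) →
           HasGCFF (Star (suc m)) (suc x)
star-cff {m} {x} A anti nonempty = B , cff
  where
  B : Fin (suc m) → Subset (suc x)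
  B zero    = inside ∷ ⊥
  B (suc i) = outside ∷ A i

  centre-leaf : ∀ j → CoverFreeEdge B zero (suc j)
  centre-leaf j = inside⊈outside , leaf⊈centre , leaf⊈centre∪leaf
    where
    leaf⊈centre : B (suc j) ⊈ B zero
    leaf⊈centre sub = let y , y∈Aj = nonempty j in ∉⊥ (drop-∷-⊆ sub y∈Aj)

    leaf⊈centre∪leaf : ∀ w → w ≢ zero → w ≢ suc j → B w ⊈ (B zero ∪ B (suc j))
    leaf⊈centre∪leaf zero    w≢0 _     _   = w≢0 refl
    leaf⊈centre∪leaf (suc i) _   i≢j sub =
      anti i j (i≢j ∘ cong suc) (subst (A i ⊆_) (∪-identityˡ (A j)) (drop-∷-⊆ sub))

  cff : IsGCFF (Star (suc m)) (suc x) B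
  cff zero    (suc j) _ = centre-leaf j
  cff (suc i) zero    _ = coverFreeEdge-sym (centre-leaf i)

middle-layer-star-cff : ∀ {x} → 1 ≤ x → HasGCFF (Star (suc (x C ⌊ x /2⌋))) (suc x)
middle-layer-star-cff {x} 1≤x =
  subst (λ m → HasGCFF (Star (suc m)) (suc x)) |layer|≡central
    (star-cff (lookup (layer x ⌈ x /2⌉)) (layer-antichain x ⌈ x /2⌉) nonempty)
  where
  |layer|≡central : length (layer x ⌈ x /2⌉) ≡ x C ⌊ x /2⌋
  |layer|≡central = trans (length-layer x ⌈ x /2⌉) (≡.sym (C-complement ⌊ x /2⌋ ⌈ x /2⌉ (⌊n/2⌋+⌈n/2⌉≡n x)))
  nonempty : ∀ i → Nonempty (lookup (layer x ⌈ x /2⌉) i)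
  nonempty i = nonempty⇐∣p∣>0 _
    (subst (0 <_) (≡.sym (All.lookup (layer-size x ⌈ x /2⌉) (∈-lookup i))) (⌈n/2⌉-mono 1≤x))

corollary5p5 : (x n : ℕ) → x ≥ 1 → n ≡ (x C (x / 2)) + 1 →
    Σ ℕ (λ m → tG≡ (Star n) m × t1≡ n m)
corollary5p5 x n x≥1 n≡ = suc x , (cff , λ _ → lower ∘ antichain) , (antichain cff , λ _ → lower)
  where
  n≡1+central : n ≡ suc (x C ⌊ x /2⌋)
  n≡1+central = trans n≡ (trans (+-comm (x C (x / 2)) 1) (cong (λ k → suc (x C k)) (n/2≡⌊n/2⌋ x)))

  cff : HasGCFF (Star n) (suc x)
  cff = subst (λ m → HasGCFF (Star m) (suc x)) (≡.sym n≡1+central) (middle-layer-star-cff x≥1)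

  antichain : ∀ {t} → HasGCFF (Star n) t → HasAntichain n t
  antichain (B , isCFF) = B , cff⇒antichain {G = Star n} (star-noIsolatedVertex 2≤n) isCFF
    where
    2≤n : 2 ≤ n
    2≤n = subst (2 ≤_) (≡.sym n≡1+central) (s≤s (0<nCk (⌊n/2⌋≤n x)))

  lower : ∀ {t} → HasAntichain n t → suc x ≤ t
  lower = antichain-lower-bound ∘ subst (λ m → HasAntichain m _) n≡1+central
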